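{- Let $A$ be a pseudo BCK-algebra and $H$ a normal deductive system of $A$. Then $H$ is a commutative deductive system of $A$ if and only if $A/H$ is a commutative pseudo BCK-algebra.
   Context: A pseudo BCK-algebra is an algebra $(A,\rightarrow,\rightsquigarrow,1)$ of type $(2,2,0)$ such that for all $x,y,z\in A$: $(x\rightarrow y)\rightsquigarrow[(y\rightarrow z)\rightsquigarrow(x\rightarrow z)]=1$; $(x\rightsquigarrow y)\rightarrow[(y\rightsquigarrow z)\rightarrow(x\rightsquigarrow z)]=1$; $1\rightarrow x=x$; $1\rightsquigarrow x=x$; $x\rightarrow 1=1$; and if $x\rightarrow y=1$ and $y\rightarrow x=1$ then $x=y$. The order is $x\le y$ iff $x\rightarrow y=1$ (iff $x\rightsquigarrow y=1$). $A$ is commutative if $(x\rightarrow y)\rightsquigarrow y=(y\rightarrow x)\rightsquigarrow x$ and $(x\rightsquigarrow y)\rightarrow y=(y\rightsquigarrow x)\rightarrow x$ for all $x,y$. A deductive system of $A$ is a subset $D\subseteq A$ with $1\in D$ such that $x\in D$ and $x\rightarrow y\in D$ imply $y\in D$. It is normal if for all $x,y$: $x\rightarrow y\in D$ iff $x\rightsquigarrow y\in D$. It is commutative if for all $x,y$: $y\rightarrow x\in D$ implies $((x\rightarrow y)\rightsquigarrow y)\rightarrow x\in D$, and $y\rightsquigarrow x\in D$ implies $((x\rightsquigarrow y)\rightarrow y)\rightsquigarrow x\in D$. For a normal deductive system $H$, the relation $\Theta_H$ given by $(x,y)\in\Theta_H$ iff $x\rightarrow y\in H$ and $y\rightarrow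 x\in H$ is a congruence, and $A/H=(A/\Theta_H,\rightarrow,\rightsquigarrow,[1]_{\Theta_H})$ with the induced operations is a pseudo BCK-algebra, with $[1]_{\Theta_H}=H$. -}

module Defs where

open import Level using (Level; _⊔_; suc)
open import Data.Product using (_×_; _,_)
open import Relation.Binary.PropositionalEquality using (_≡_)
open import Relation.Unary using (Pred; _∈_)

record PseudoBCK (a : Level) : Set (suc a) where
  infixr 5 _⇒_ _⇝_
  field
    Carrier : Set a
    _⇒_     : Carrier → Carrier → Carrier
    _⇝_     : Carrier → Carrier → Carrier
    𝟏       : Carrier
    ax1     : ∀ x y z → ((x ⇒ y) ⇝ ((y ⇒ z) ⇝ (x ⇒ z))) ≡ 𝟏
    ax2     : ∀ x y z → ((x ⇝ y) ⇒ ((y ⇝ z) ⇒ (x ⇝ z))) ≡ 𝟏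
    ax3     : ∀ x → (𝟏 ⇒ x) ≡ x
    ax4     : ∀ x → (𝟏 ⇝ x) ≡ x
    ax5     : ∀ x → (x ⇒ 𝟏) ≡ 𝟏
    ax6     : ∀ x y → (x ⇒ y) ≡ 𝟏 → (y ⇒ x) ≡ 𝟏 → x ≡ y

-- The signature (carrier, equality relation, →, ⇝, 1) of an algebra of type (2,2,0)
-- whose equality is a given relation _≈_ (used for quotients A/H, whose carrier
-- is A with equality Θ_H).
record PBCKSignature (a ℓ : Level) : Set (suc (a ⊔ ℓ)) where
  field
    Carrier : Set a
    _≈_     : Carrier → Carrier → Set ℓ
    _⇒_     : Carrier → Carrier → Carrier
    _⇝_     : Carrier → Carrier → Carrier
    𝟏       : Carrier

IsCommutative : ∀ {a ℓ} → PBCKSignature a ℓ → Set (a ⊔ ℓ)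
IsCommutative S = ∀ x y →
    (((x ⇒ y) ⇝ y) ≈ ((y ⇒ x) ⇝ x))
  × (((x ⇝ y) ⇒ y) ≈ ((y ⇝ x) ⇒ x))
  where open PBCKSignature S

module _ {a : Level} (A : PseudoBCK a) where
  open PseudoBCK A

  IsDeductiveSystem : ∀ {ℓ} → Pred Carrier ℓ → Set (a ⊔ ℓ)
  IsDeductiveSystem D = (𝟏 ∈ D) × (∀ {x y} → x ∈ D → (x ⇒ y) ∈ D → y ∈ D)

  IsNormal : ∀ {ℓ} → Pred Carrier ℓ → Set (a ⊔ ℓ)
  IsNormal D = IsDeductiveSystem D
             × (∀ x y → ((x ⇒ y) ∈ D → (x ⇝ y) ∈ D) × ((x ⇝ y) ∈ D → (x ⇒ y) ∈ D))

  IsCommutativeDS : ∀ {ℓ} → Pred Carrier ℓ → Set (a ⊔ ℓ)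
  IsCommutativeDS D = IsDeductiveSystem D
    × (∀ x y → ((y ⇒ x) ∈ D → ((((x ⇒ y) ⇝ y) ⇒ x) ∈ D))
             × ((y ⇝ x) ∈ D → ((((x ⇝ y) ⇒ y) ⇝ x) ∈ D)))

  Θ : ∀ {ℓ} → Pred Carrier ℓ → Carrier → Carrier → Set ℓ
  Θ H x y = ((x ⇒ y) ∈ H) × ((y ⇒ x) ∈ H)

  -- The quotient A/H: carrier A with equality Θ_H and the induced operations
  -- (well-defined since Θ_H is a congruence for normal H).
  _/_ : ∀ {ℓ} (H : Pred Carrier ℓ) → IsNormal H → PBCKSignature a ℓ
  _/_ {ℓ} H _ = record
    { Carrier = Carrier ; _≈_ = Θ H ; _⇒_ = _⇒_ ; _⇝_ = _⇝_ ; 𝟏 = 𝟏 }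

-- By normality, H is closed under modus ponens for both implications, and the
-- exchange law x → (y ⇝ z) = y ⇝ (x → z) moves a hypothesis y → x across ⇝.
-- If H is commutative, apply its defining condition to v = (x → y) ⇝ y, which
-- lies above both x and y, to get ((y → x) ⇝ x) → v ∈ H; conversely, from
-- ((x → y) ⇝ y) → ((y → x) ⇝ x) ∈ H and y → x ∈ H, exchange and modus ponens
-- give ((x → y) ⇝ y) → x ∈ H. The ⇝-halves are the →-halves of the dual
-- algebra, in which the two implications are swapped.
module Submission where

open import Defs
open import Function.Bundles using (_⇔_; mk⇔)
open import Data.Product using (_,_; proj₁; proj₂; map; swap)
open import Relation.Binary.PropositionalEquality
open import Relation.Unary using (Pred; _∈_)

module Properties {a} (A : PseudoBCK a) where
  open PseudoBCK A

  infix 4 _≤_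
  _≤_ : Carrier → Carrier → Set a
  x ≤ y = x ⇒ y ≡ 𝟏

  x⇝[x⇒y]⇝y≡𝟏 : ∀ x y → x ⇝ ((x ⇒ y) ⇝ y) ≡ 𝟏
  x⇝[x⇒y]⇝y≡𝟏 x y =
    trans (cong₂ (λ p q → p ⇝ ((x ⇒ y) ⇝ q)) (sym (ax3 x)) (sym (ax3 y))) (ax1 𝟏 x y)

  x≤[x⇝y]⇒y : ∀ x y → x ≤ (x ⇝ y) ⇒ y
  x≤[x⇝y]⇒y x y =
    trans (cong₂ (λ p q → p ⇒ ((x ⇝ y) ⇒ q)) (sym (ax4 x)) (sym (ax4 y))) (ax2 𝟏 x y)

  ≤-refl : ∀ x → x ≤ x
  ≤-refl x = begin
    x ⇒ x                 ≡⟨ cong (_⇒ x) (sym (ax4 x)) ⟩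
    (𝟏 ⇝ x) ⇒ x           ≡⟨ sym (ax3 _) ⟩
    𝟏 ⇒ ((𝟏 ⇝ x) ⇒ x)     ≡⟨ x≤[x⇝y]⇒y 𝟏 x ⟩
    𝟏                     ∎
    where open ≡-Reasoning

  ⇝≡𝟏⇒≤ : ∀ {x y} → x ⇝ y ≡ 𝟏 → x ≤ y
  ⇝≡𝟏⇒≤ {x} {y} x⇝y≡𝟏 =
    trans (cong (x ⇒_) (trans (sym (ax3 y)) (cong (_⇒ y) (sym x⇝y≡𝟏)))) (x≤[x⇝y]⇒y x y)

  ≤⇒⇝≡𝟏 : ∀ {x y} → x ≤ y → x ⇝ y ≡ 𝟏
  ≤⇒⇝≡𝟏 {x} {y} x≤y =
    trans (cong (x ⇝_) (trans (sym (ax4 y)) (cong (_⇝ y) (sym x≤y)))) (x⇝[x⇒y]⇝y≡𝟏 x y)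

  x⇝𝟏≡𝟏 : ∀ x → x ⇝ 𝟏 ≡ 𝟏
  x⇝𝟏≡𝟏 x = ≤⇒⇝≡𝟏 (ax5 x)

  ⇝-antisym : ∀ x y → x ⇝ y ≡ 𝟏 → y ⇝ x ≡ 𝟏 → x ≡ y
  ⇝-antisym x y p q = ax6 x y (⇝≡𝟏⇒≤ p) (⇝≡𝟏⇒≤ q)

  x≤[x⇒y]⇝y : ∀ x y → x ≤ (x ⇒ y) ⇝ y
  x≤[x⇒y]⇝y x y = ⇝≡𝟏⇒≤ (x⇝[x⇒y]⇝y≡𝟏 x y)

  ⇒-antitoneˡ : ∀ {x y} z → x ≤ y → y ⇒ z ≤ x ⇒ z
  ⇒-antitoneˡ {x} {y} z x≤y =
    ⇝≡𝟏⇒≤ (trans (sym (ax4 _)) (trans (cong (_⇝ _) (sym x≤y)) (ax1 x y z)))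

  ⇝-antitoneˡ : ∀ {x y} z → x ≤ y → y ⇝ z ≤ x ⇝ z
  ⇝-antitoneˡ {x} {y} z x≤y =
    trans (sym (ax3 _)) (trans (cong (_⇒ _) (sym (≤⇒⇝≡𝟏 x≤y))) (ax2 x y z))

  ≤-trans : ∀ {x y z} → x ≤ y → y ≤ z → x ≤ z
  ≤-trans {x} {y} {z} x≤y y≤z =
    trans (sym (ax3 _)) (trans (cong (_⇒ (x ⇒ z)) (sym y≤z)) (⇒-antitoneˡ z x≤y))

  swap-⇒⇝ : ∀ {x y z} → x ≤ y ⇒ z → y ≤ x ⇝ z
  swap-⇒⇝ {x} {y} {z} x≤y⇒z = ≤-trans (x≤[x⇒y]⇝y y z) (⇝-antitoneˡ z x≤y⇒z)

  swap-⇝⇒ : ∀ {x y z} → x ≤ y ⇝ z → y ≤ x ⇒ z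
  swap-⇝⇒ {x} {y} {z} x≤y⇝z = ≤-trans (x≤[x⇝y]⇒y y z) (⇒-antitoneˡ z x≤y⇝z)

  y≤[x⇒y]⇝y : ∀ x y → y ≤ (x ⇒ y) ⇝ y
  y≤[x⇒y]⇝y x y = swap-⇒⇝ (trans (cong ((x ⇒ y) ⇒_) (≤-refl y)) (ax5 _))

  ⇒⇝-exchange : ∀ x y z → x ⇒ (y ⇝ z) ≡ y ⇝ (x ⇒ z)
  ⇒⇝-exchange x y z = ax6 _ _
    (swap-⇒⇝ (≤-trans (x≤[x⇝y]⇒y y z) (swap-⇝⇒ (⇝≡𝟏⇒≤ (ax1 x (y ⇝ z) z)))))
    (swap-⇝⇒ (≤-trans (x≤[x⇒y]⇝y x z) (swap-⇒⇝ (ax2 y (x ⇒ z) z))))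

dual : ∀ {a} → PseudoBCK a → PseudoBCK a
dual A = record
  { Carrier = Carrier ; _⇒_ = _⇝_ ; _⇝_ = _⇒_ ; 𝟏 = 𝟏
  ; ax1 = ax2 ; ax2 = ax1 ; ax3 = ax4 ; ax4 = ax3
  ; ax5 = x⇝𝟏≡𝟏 ; ax6 = ⇝-antisym }
  where open PseudoBCK A
        open Properties A

module _ {a ℓ} (A : PseudoBCK a) (H : Pred (PseudoBCK.Carrier A) ℓ) where
  open PseudoBCK A

  dual-normal : IsNormal A H → IsNormal (dual A) H
  dual-normal ((𝟏∈H , mp) , normal) =
    (𝟏∈H , λ x∈H x⇝y∈H → mp x∈H (proj₂ (normal _ _) x⇝y∈H)) , λ x y → swap (normal x y)

  ⇒-CommutativeDS : Set _
  ⇒-CommutativeDS = ∀ x y → (y ⇒ x) ∈ H → (((x ⇒ y) ⇝ y) ⇒ x) ∈ H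

  ⇒-CommutativeQuotient : Set _
  ⇒-CommutativeQuotient = ∀ x y → Θ A H ((x ⇒ y) ⇝ y) ((y ⇒ x) ⇝ x)

module NormalDS {a ℓ} (A : PseudoBCK a) (H : Pred (PseudoBCK.Carrier A) ℓ)
                (N : IsNormal A H) where
  open PseudoBCK A
  open Properties A

  private
    𝟏∈H : 𝟏 ∈ H
    𝟏∈H = proj₁ (proj₁ N)

    mp : ∀ {x y} → x ∈ H → (x ⇒ y) ∈ H → y ∈ H
    mp = proj₂ (proj₁ N)

    ⇒∈H⇒⇝∈H : ∀ {x y} → (x ⇒ y) ∈ H → (x ⇝ y) ∈ H
    ⇒∈H⇒⇝∈H = proj₁ (proj₂ N _ _)

    ⇝∈H⇒⇒∈H : ∀ {x y} → (x ⇝ y) ∈ H → (x ⇒ y) ∈ H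
    ⇝∈H⇒⇒∈H = proj₂ (proj₂ N _ _)

  ≤⇒⇒∈H : ∀ {x y} → x ≤ y → (x ⇒ y) ∈ H
  ≤⇒⇒∈H x≤y = subst (_∈ H) (sym x≤y) 𝟏∈H

  ∈-upward-closed : ∀ {x y} → x ∈ H → x ≤ y → y ∈ H
  ∈-upward-closed x∈H x≤y = mp x∈H (≤⇒⇒∈H x≤y)

  commutativeDS⇒commutativeQuotient : ⇒-CommutativeDS A H → ⇒-CommutativeQuotient A H
  commutativeDS⇒commutativeQuotient comm x y = below y x , below x y
    where
    below : ∀ x y → (((y ⇒ x) ⇝ x) ⇒ ((x ⇒ y) ⇝ y)) ∈ H
    below x y = ∈-upward-closed (comm v x (≤⇒⇒∈H (x≤[x⇒y]⇝y x y)))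
                  (⇒-antitoneˡ v (⇝-antitoneˡ x (⇒-antitoneˡ x (y≤[x⇒y]⇝y x y))))
      where v = (x ⇒ y) ⇝ y

  commutativeQuotient⇒commutativeDS : ⇒-CommutativeQuotient A H → ⇒-CommutativeDS A H
  commutativeQuotient⇒commutativeDS comm x y y⇒x∈H =
    mp y⇒x∈H (⇝∈H⇒⇒∈H (subst (_∈ H) (⇒⇝-exchange _ (y ⇒ x) x) (proj₁ (comm x y))))

  dualΘ⇒Θ : ∀ {x y} → Θ (dual A) H x y → Θ A H x y
  dualΘ⇒Θ = map ⇝∈H⇒⇒∈H ⇝∈H⇒⇒∈H

  Θ⇒dualΘ : ∀ {x y} → Θ A H x y → Θ (dual A) H x y
  Θ⇒dualΘ = map ⇒∈H⇒⇝∈H ⇒∈H⇒⇝∈H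

theorem4p9 : ∀ {a ℓ} (A : PseudoBCK a) (H : Pred (PseudoBCK.Carrier A) ℓ)
    (N : IsNormal A H) →
    IsCommutativeDS A H ⇔ IsCommutative (_/_ A H N)
theorem4p9 A H N = mk⇔
  (λ (_ , comm) x y →
      ⇒.commutativeDS⇒commutativeQuotient (λ x y → proj₁ (comm x y)) x y
    , ⇒.dualΘ⇒Θ (⇝.commutativeDS⇒commutativeQuotient (λ x y → proj₂ (comm x y)) x y))
  (λ comm → proj₁ N , λ x y →
      ⇒.commutativeQuotient⇒commutativeDS (λ x y → proj₁ (comm x y)) x y
    , ⇝.commutativeQuotient⇒commutativeDS (λ x y → ⇒.Θ⇒dualΘ (proj₂ (comm x y))) x y)
  where
  module ⇒ = NormalDS A H N
  module ⇝ = NormalDS (dual A) H (dual-normal A H N)
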